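{- Let $\alpha>1/2$. There is no online algorithm for the lax static case of \textsc{Knapsack} that has competitive ratio $\alpha$ and an amortized migration factor bounded by a constant $B$ (independent of the instance), when migration is measured by weight.
   Context: \textsc{Knapsack}: a capacity $C\in\mathbb N$ and items $i$ with weight $w_i\in\mathbb N$ and profit $p_i\in\mathbb N$; a subset is feasible iff its total weight is at most $C$, and its profit is the sum of its profits. Lax static case: at time $1$ an arbitrary instance $I_1$ is presented, contributing no migration potential. Afterwards, at each step one item arrives, and items never depart. The algorithm outputs a feasible $S_t$ at each time without knowledge of the future. Competitive ratio $\alpha$ means $\mathrm{profit}(S_t)\ge\alpha\,\mathrm{opt}(I_t)$ for all $t$. Migration measured by weight: the migration potential of a step is the weight of the arriving item. The migration cost of changing $S_{t-1}$ to $S_t$ is the total weight of $S_{t-1}\triangle S_t$, excluding the newly arrived item. The amortized migration factor is bounded by $B$ if for every $t$ the total migration cost up to $t$ is at most $B$ times the total migration potential up to $t$.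
   Formalization: The competitive ratio α ranges over the rationals greater than 1/2, and the constant B bounding the amortized migration factor is taken in the rationals. -}

module Defs where

open import Data.Bool using (Bool; true; false; if_then_else_; _xor_)
open import Data.Nat using (ℕ; zero; suc; _+_; _≤_; _≤?_; _⊔_)
open import Data.List using (List; []; _∷_; _++_; map; filter; foldr; length)
open import Data.Nat.ListAction using (sum)
open import Data.Integer using (+_)
open import Data.Rational using (ℚ; _/_)
import Data.Rational as ℚ
open import Data.Product using (Σ; _×_)
open import Relation.Nullary using (¬_)

record Item : Set where
  constructor item
  field
    w : ℕ
    p : ℕ
open Item public

-- A selection (subset) of the items of a list L: item at position i is
-- selected iff s i ≡ true.  Only positions < length L are relevant.
Selection : Set
Selection = ℕ → Bool

selWeight : List Item → Selection → ℕ
selWeight []       s = 0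
selWeight (x ∷ xs) s = (if s 0 then w x else 0) + selWeight xs (λ i → s (suc i))

selProfit : List Item → Selection → ℕ
selProfit []       s = 0
selProfit (x ∷ xs) s = (if s 0 then p x else 0) + selProfit xs (λ i → s (suc i))

Feasible : ℕ → List Item → Selection → Set
Feasible C L s = selWeight L s ≤ C

cons : Bool → Selection → Selection
cons b s zero    = b
cons b s (suc i) = s i

noneSel : Selection
noneSel _ = false

selections : ℕ → List Selection
selections zero    = noneSel ∷ []
selections (suc n) = map (cons false) (selections n) ++ map (cons true) (selections n)

opt : ℕ → List Item → ℕ
opt C L = foldr _⊔_ 0
  (map (selProfit L) (filter (λ s → selWeight L s ≤? C) (selections (length L))))

-- weight of the symmetric difference of two selections, restricted to the
-- items of L (the newly arriving item is not in L, hence excluded)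
diffWeight : List Item → Selection → Selection → ℕ
diffWeight []       s t = 0
diffWeight (x ∷ xs) s t =
  (if s 0 xor t 0 then w x else 0)
    + diffWeight xs (λ i → s (suc i)) (λ i → t (suc i))

-- A deterministic online algorithm for the lax static case: given the
-- capacity C, the initial instance I₁ and the list `as` of items that have
-- arrived since (in arrival order), it outputs the selection S_t for the
-- current item list I₁ ++ as.  Being a function of the prefix only, it has
-- no knowledge of the future.
OnlineAlg : Set
OnlineAlg = (C : ℕ) → (I₁ : List Item) → (as : List Item) → Selection

-- current instance items at time t = 1 + length as
items : List Item → List Item → List Item
items I₁ as = I₁ ++ as

toℚ : ℕ → ℚ
toℚ n = + n / 1

AlwaysFeasible : OnlineAlg → Set
AlwaysFeasible A = ∀ C I₁ as → Feasible C (items I₁ as) (A C I₁ as)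

Competitive : ℚ → OnlineAlg → Set
Competitive α A = ∀ C I₁ as →
  α ℚ.* toℚ (opt C (items I₁ as)) ℚ.≤ toℚ (selProfit (items I₁ as) (A C I₁ as))

stepCost : OnlineAlg → ℕ → List Item → List Item → Item → ℕ
stepCost A C I₁ pre x =
  diffWeight (items I₁ pre) (A C I₁ pre) (A C I₁ (pre ++ (x ∷ [])))

migFrom : OnlineAlg → ℕ → List Item → List Item → List Item → ℕ
migFrom A C I₁ pre []         = 0
migFrom A C I₁ pre (x ∷ rest) = stepCost A C I₁ pre x + migFrom A C I₁ (pre ++ (x ∷ [])) rest

totalMigration : OnlineAlg → ℕ → List Item → List Item → ℕ
totalMigration A C I₁ as = migFrom A C I₁ [] as

totalPotential : List Item → ℕ
totalPotential as = sum (map w as)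

AmortizedMigrationBounded : ℚ → OnlineAlg → Set
AmortizedMigrationBounded B A = ∀ C I₁ as →
  toℚ (totalMigration A C I₁ as) ℚ.≤ B ℚ.* toℚ (totalPotential as)

{-# OPTIONS --safe #-}
-- Adversary: start with a single item of weight C and profit 1. Since α > 0 the
-- algorithm must pack it. Then two items of weight 1 and profit 1 arrive: now
-- opt = 2, while any solution keeping the big item has profit 1 < 2α, so the big
-- item must be dropped at migration cost C. The migration potential was only 2,
-- so choosing C > 2B violates the amortized bound.
module Submission where

open import Defs
open import Data.Rational using (ℚ; _<_; ½; mkℚ; *<*; *≤*)
import Data.Rational as Q
import Data.Rational.Properties as QP
open import Data.Integer using (+_; -[1+_]; +<+; +≤+; -<+)
import Data.Integer as Z
import Data.Integer.Properties as ZP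
open import Data.Nat using (ℕ; suc; _+_; _*_; _≤_; _⊔_; z≤n; s≤s)
import Data.Nat as N
import Data.Nat.Properties as NP
import Data.Nat.Coprimality as Coprime
open import Data.Bool using (true; false)
open import Data.Bool.Properties using (¬-not)
open import Data.List using (List; []; _∷_; _++_; foldr; length)
open import Data.List.Membership.Propositional using (_∈_)
open import Data.List.Membership.Propositional.Properties using (∈-filter⁺; ∈-map⁺)
open import Data.List.Relation.Unary.Any using (here; there)
open import Data.Product using (Σ; ∃; _×_; _,_)
open import Relation.Nullary using (¬_; contradiction)
open import Relation.Binary.PropositionalEquality

toℚ≡mkℚ : ∀ n → toℚ n ≡ mkℚ (+ n) 0 (Coprime.sym (Coprime.1-coprimeTo n))
toℚ≡mkℚ n = QP.normalize-coprime (Coprime.sym (Coprime.1-coprimeTo n))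

toℚ-mono-≤ : ∀ {m n} → m ≤ n → toℚ m Q.≤ toℚ n
toℚ-mono-≤ {m} {n} m≤n rewrite toℚ≡mkℚ m | toℚ≡mkℚ n =
  *≤* (subst₂ Z._≤_ (sym (ZP.*-identityʳ (+ m))) (sym (ZP.*-identityʳ (+ n))) (+≤+ m≤n))

toℚ-cancel-< : ∀ {m n} → toℚ m < toℚ n → m N.< n
toℚ-cancel-< {m} {n} m<n rewrite toℚ≡mkℚ m | toℚ≡mkℚ n =
  ZP.drop‿+<+ (subst₂ Z._<_ (ZP.*-identityʳ (+ m)) (ZP.*-identityʳ (+ n)) (QP.drop-*<* m<n))

toℚ-homo-* : ∀ m n → toℚ (m * n) ≡ toℚ m Q.* toℚ n
toℚ-homo-* m n rewrite toℚ≡mkℚ m | toℚ≡mkℚ n = cong (Q._/ 1) (ZP.pos-* m n)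

toℚ-pos : ∀ n → Q.Positive (toℚ (suc n))
toℚ-pos n = QP.normalize-pos (suc n) 1

toℚ-unbounded : ∀ q → ∃ λ n → q < toℚ n
toℚ-unbounded q@(mkℚ (+ n) d _) = suc n , subst (q <_) (sym (toℚ≡mkℚ (suc n)))
  (*<* (subst₂ Z._<_ (sym (ZP.*-identityʳ (+ n))) (ZP.pos-* (suc n) (suc d))
     (+<+ (s≤s (NP.≤-trans (NP.m≤m*n n (suc d)) (NP.m≤n+m _ d))))))
toℚ-unbounded q@(mkℚ -[1+ n ] d _) = 0 , subst (q <_) (sym (toℚ≡mkℚ 0)) (*<* -<+)

α*n≤m⇒n<2*m : ∀ {α} → ½ < α → ∀ n m → 0 N.< n → α Q.* toℚ n Q.≤ toℚ m → n N.< 2 * m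
α*n≤m⇒n<2*m {α} ½<α (suc n) m _ αn≤m = toℚ-cancel-< (begin-strict
  -- toℚ 2 * ½ computes to 1ℚ
  toℚ (suc n)                     ≡⟨ sym (QP.*-identityˡ (toℚ (suc n))) ⟩
  (toℚ 2 Q.* ½) Q.* toℚ (suc n)   ≡⟨ QP.*-assoc (toℚ 2) ½ (toℚ (suc n)) ⟩
  toℚ 2 Q.* (½ Q.* toℚ (suc n))   <⟨ QP.*-monoʳ-<-pos (toℚ 2) (QP.*-monoˡ-<-pos (toℚ (suc n)) ½<α) ⟩
  toℚ 2 Q.* (α Q.* toℚ (suc n))   ≤⟨ QP.*-monoˡ-≤-nonNeg (toℚ 2) αn≤m ⟩
  toℚ 2 Q.* toℚ m                 ≡⟨ toℚ-homo-* 2 m ⟨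
  toℚ (2 * m)                     ∎)
  where
  open QP.≤-Reasoning
  instance _ = toℚ-pos n

∈⇒≤foldr-⊔ : ∀ {x xs} → x ∈ xs → x ≤ foldr _⊔_ 0 xs
∈⇒≤foldr-⊔ {x} {_ ∷ xs} (here refl) = NP.m≤m⊔n x (foldr _⊔_ 0 xs)
∈⇒≤foldr-⊔ {x} {y ∷ xs} (there x∈xs) = NP.≤-trans (∈⇒≤foldr-⊔ x∈xs) (NP.m≤n⊔m y _)

selProfit≤opt : ∀ C L s → s ∈ selections (length L) → Feasible C L s → selProfit L s ≤ opt C L
selProfit≤opt C L s s∈ feasible =
  ∈⇒≤foldr-⊔ (∈-map⁺ (selProfit L) (∈-filter⁺ (λ t → selWeight L t N.≤? C) s∈ feasible))

big : ℕ → Item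
big C = item C 1

small : Item
small = item 1 1

initial : ℕ → List Item
initial C = big C ∷ []

arrivals : List Item
arrivals = small ∷ small ∷ []

1≤opt-initial : ∀ C → 1 ≤ opt C (initial C)
1≤opt-initial C =
  selProfit≤opt C (initial C) (cons true noneSel) (there (here refl)) (NP.≤-reflexive (NP.+-identityʳ C))

2≤opt-final : ∀ k → 2 ≤ opt (2 + k) (initial (2 + k) ++ arrivals)
2≤opt-final k = selProfit≤opt (2 + k) (initial (2 + k) ++ arrivals) (cons false (cons true (cons true noneSel)))
  (there (there (there (here refl)))) (s≤s (s≤s z≤n))

big-blocks-smalls : ∀ k s → Feasible (2 + k) (initial (2 + k) ++ arrivals) s → s 0 ≡ true →
                    selProfit (initial (2 + k) ++ arrivals) s ≡ 1
big-blocks-smalls k s feasible s0≡true rewrite s0≡true with s 1 | s 2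
... | false | false = refl
... | true  | _     = contradiction feasible (NP.m+1+n≰m (2 + k))
... | false | true  = contradiction feasible (NP.m+1+n≰m (2 + k))

module _ {α : ℚ} (½<α : ½ < α) where

  big-taken : ∀ C s → α Q.* toℚ (opt C (initial C)) Q.≤ toℚ (selProfit (initial C) s) → s 0 ≡ true
  big-taken C s competitive with s 0 | α*n≤m⇒n<2*m ½<α _ (selProfit (initial C) s) (1≤opt-initial C) competitive
  ... | true  | _        = refl
  ... | false | opt<2*0  = contradiction opt<2*0 NP.n≮0

  big-dropped : ∀ k s → let L = initial (2 + k) ++ arrivals in
                Feasible (2 + k) L s → α Q.* toℚ (opt (2 + k) L) Q.≤ toℚ (selProfit L s) → s 0 ≡ false
  big-dropped k s feasible competitive = ¬-not λ s0≡true →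
    NP.<-irrefl refl (begin-strict
      2                                  ≤⟨ 2≤opt-final k ⟩
      opt (2 + k) L                      <⟨ α*n≤m⇒n<2*m ½<α _ (selProfit L s) (NP.≤-trans (s≤s z≤n) (2≤opt-final k)) competitive ⟩
      2 * selProfit L s                  ≡⟨ cong (2 *_) (big-blocks-smalls k s feasible s0≡true) ⟩
      2                                  ∎)
    where
    open NP.≤-Reasoning
    L = initial (2 + k) ++ arrivals

unselecting-big-costs-C : ∀ C (s₀ s₁ s₂ : Selection) → s₀ 0 ≡ true → s₂ 0 ≡ false →
  C ≤ diffWeight (initial C) s₀ s₁ + diffWeight (initial C ++ small ∷ []) s₁ s₂
unselecting-big-costs-C C s₀ s₁ s₂ s₀0≡true s₂0≡false rewrite s₀0≡true | s₂0≡false with s₁ 0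
... | true  = NP.m≤m+n C _
... | false = NP.≤-trans (NP.m≤m+n C 0) (NP.m≤m+n (C + 0) _)

dropping-big-costs-C : ∀ A C → A C (initial C) [] 0 ≡ true → A C (initial C) arrivals 0 ≡ false →
                       C ≤ totalMigration A C (initial C) arrivals
dropping-big-costs-C A C s₀0≡true s₂0≡false = begin
  C                                             ≤⟨ unselecting-big-costs-C C s₀ s₁ s₂ s₀0≡true s₂0≡false ⟩
  diffWeight I s₀ s₁ + diffWeight I₁ s₁ s₂       ≡⟨ cong (λ m → diffWeight I s₀ s₁ + m) (NP.+-identityʳ _) ⟨
  totalMigration A C I arrivals                 ∎
  where
  open NP.≤-Reasoning
  I  = initial C
  I₁ = I ++ small ∷ []
  s₀ = A C I []
  s₁ = A C I (small ∷ [])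
  s₂ = A C I arrivals

theorem18 : (α : ℚ) → ½ < α →
    ¬ (Σ OnlineAlg λ A → Σ ℚ λ B →
    AlwaysFeasible A × Competitive α A × AmortizedMigrationBounded B A)
theorem18 α ½<α (A , B , feasible , competitive , bounded) with toℚ-unbounded (B Q.* toℚ 2)
... | N , B*2<N = NP.<⇒≱ (toℚ-cancel-< toℚC<toℚN) (NP.m≤n+m N 2)
  where
  open QP.≤-Reasoning
  C = 2 + N
  I = initial C

  big-taken-first : A C I [] 0 ≡ true
  big-taken-first = big-taken ½<α C (A C I []) (competitive C I [])

  big-dropped-last : A C I arrivals 0 ≡ false
  big-dropped-last = big-dropped ½<α N (A C I arrivals) (feasible C I arrivals) (competitive C I arrivals)

  toℚC<toℚN : toℚ C < toℚ N
  toℚC<toℚN = begin-strict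
    toℚ C                                ≤⟨ toℚ-mono-≤ (dropping-big-costs-C A C big-taken-first big-dropped-last) ⟩
    toℚ (totalMigration A C I arrivals)  ≤⟨ bounded C I arrivals ⟩
    B Q.* toℚ 2                          <⟨ B*2<N ⟩
    toℚ N                                ∎
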